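{- Let $L$ be a three-dimensional lattice, $f : L \to L$, and let $x, y \in L$ with $x \preceq y$, $x \in \mathrm{Up}(f)$ and $y \in \mathrm{Down}(f)$. Let $s = (*,*,s_3)$ be a principal slice with $x_3 \le s_3 \le y_3$, and define $a = (x_1, x_2, s_3)$ and $b = (y_1, y_2, s_3)$. Then either $L_{a,b}$ satisfies the invariant, or $x$ and $a$ witness a violation of order preservation of $f$, or $b$ and $y$ witness a violation of order preservation of $f$.
   Context: $L = L(n_1,n_2,n_3)$ is the set of $x \in \mathbb{N}^3$ with $1 \le x_i \le n_i$, ordered componentwise by $\preceq$; $L_{a,b}=\{c : a\preceq c\preceq b\}$. $\mathrm{Up}(f)=\{x : x \preceq f(x)\}$, $\mathrm{Down}(f)=\{x : f(x)\preceq x\}$. $L_s = \{x \in L : x_3 = s_3\}$; $f_s : L_s \to L_s$ with $f_s(x)_i = f(x)_i$ for $i\in\{1,2\}$, $f_s(x)_3 = s_3$; $\mathrm{Up}(f_s)=\{z\in L_s : z\preceq f_s(z)\}$, $\mathrm{Down}(f_s)=\{z\in L_s : f_s(z)\preceq z\}$. Two points $p\preceq q$ (in either order as listed) witness a violation of order preservation if $f(p)\not\preceq f(q)$. A down set witness is a pair $(d,b)$ with $d,b\in L_s$, $d_3\le f(d)_3$, $b_3\le f(b)_3$, and $i\ne j\in\{1,2\}$ with $d_i=b_i$, $d_j\le b_j$, $d_j\le f(d)_j$, $f(b)_j\le b_j$. An up set witness is a pair $(a,u)$ with $a,u\in L_s$, $a_3\ge f(a)_3$, $u_3\ge f(u)_3$,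 and $i\ne j\in\{1,2\}$ with $a_i=u_i$, $u_j\ge a_j$, $u_j\ge f(u)_j$, $f(a)_j\ge a_j$. $L_{a,b}$ satisfies the invariant if: either $a\in\mathrm{Up}(f_s)$ or there is an up set witness $(a,u)$ with $u\preceq b$; either $b\in\mathrm{Down}(f_s)$ or there is a down set witness $(d,b)$ with $a\preceq d$; and if both witnesses are used then $u\preceq d$. -}

module Defs where

open import Data.Nat using (ℕ; _≤_)
open import Data.Fin using (Fin; zero; suc)
open import Data.Product using (Σ; _×_; _,_; ∃-syntax)
open import Data.Sum using (_⊎_)
open import Relation.Nullary using (¬_)
open import Relation.Binary.PropositionalEquality using (_≡_; _≢_)

Pt : Set
Pt = ℕ × ℕ × ℕ

p₁ p₂ p₃ : Pt → ℕ
p₁ (a , _ , _) = a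
p₂ (_ , b , _) = b
p₃ (_ , _ , c) = c

crd : Fin 2 → Pt → ℕ
crd zero    x = p₁ x
crd (suc _) x = p₂ x

InL : Pt → Pt → Set
InL n x = (1 ≤ p₁ x × p₁ x ≤ p₁ n) × (1 ≤ p₂ x × p₂ x ≤ p₂ n) × (1 ≤ p₃ x × p₃ x ≤ p₃ n)

_⪯_ : Pt → Pt → Set
x ⪯ y = p₁ x ≤ p₁ y × p₂ x ≤ p₂ y × p₃ x ≤ p₃ y

MapsL : Pt → (Pt → Pt) → Set
MapsL n f = ∀ x → InL n x → InL n (f x)

InLs : Pt → ℕ → Pt → Set
InLs n s₃ x = InL n x × p₃ x ≡ s₃

fs : (Pt → Pt) → ℕ → Pt → Pt
fs f s₃ x = (p₁ (f x) , p₂ (f x) , s₃)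

UpS : (Pt → Pt) → ℕ → Pt → Set
UpS f s₃ z = z ⪯ fs f s₃ z

DownS : (Pt → Pt) → ℕ → Pt → Set
DownS f s₃ z = fs f s₃ z ⪯ z

DownWit : Pt → (Pt → Pt) → ℕ → Pt → Pt → Set
DownWit n f s₃ d b =
  InLs n s₃ d × InLs n s₃ b × p₃ d ≤ p₃ (f d) × p₃ b ≤ p₃ (f b) ×
  (∃[ i ] ∃[ j ] (i ≢ j × crd i d ≡ crd i b × crd j d ≤ crd j b ×
                  crd j d ≤ crd j (f d) × crd j (f b) ≤ crd j b))

UpWit : Pt → (Pt → Pt) → ℕ → Pt → Pt → Set
UpWit n f s₃ a u =
  InLs n s₃ a × InLs n s₃ u × p₃ (f a) ≤ p₃ a × p₃ (f u) ≤ p₃ u ×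
  (∃[ i ] ∃[ j ] (i ≢ j × crd i a ≡ crd i u × crd j a ≤ crd j u ×
                  crd j (f u) ≤ crd j u × crd j a ≤ crd j (f a)))

Invariant : Pt → (Pt → Pt) → ℕ → Pt → Pt → Set
Invariant n f s₃ a b =
    (UpS f s₃ a × DownS f s₃ b)
  ⊎ (UpS f s₃ a × ∃[ d ] (DownWit n f s₃ d b × a ⪯ d))
  ⊎ (∃[ u ] (UpWit n f s₃ a u × u ⪯ b) × DownS f s₃ b)
  ⊎ (∃[ u ] ∃[ d ] (UpWit n f s₃ a u × u ⪯ b × DownWit n f s₃ d b × a ⪯ d × u ⪯ d))

Violation : (Pt → Pt) → Pt → Pt → Set
Violation f p q = (p ⪯ q × ¬ (f p ⪯ f q)) ⊎ (q ⪯ p × ¬ (f q ⪯ f p))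

-- If f is order preserving on the two vertical segments x ⪯ a and b ⪯ y, then
-- x ⪯ f x ⪯ f a puts a in Up(f_s) and f b ⪯ f y ⪯ y puts b in Down(f_s), so
-- L_{a,b} satisfies the invariant without any witnesses. Otherwise one of the
-- two segments exhibits a violation of order preservation.
module Submission where

open import Defs
open import Data.Nat using (ℕ; _≤_; _≤?_)
open import Data.Nat.Properties using (≤-refl; ≤-trans)
open import Data.Product using (_×_; _,_)
open import Data.Sum using (_⊎_; inj₁; inj₂)
open import Relation.Nullary using (Dec; yes; no)
open import Relation.Nullary.Decidable using (_×-dec_)

_⪯?_ : (p q : Pt) → Dec (p ⪯ q)
p ⪯? q = (p₁ p ≤? p₁ q) ×-dec ((p₂ p ≤? p₂ q) ×-dec (p₃ p ≤? p₃ q))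

⪯-monotone-or-violation : (f : Pt → Pt) {p q : Pt} → p ⪯ q →
                          f p ⪯ f q ⊎ Violation f p q
⪯-monotone-or-violation f {p} {q} p⪯q with f p ⪯? f q
... | yes fp⪯fq = inj₁ fp⪯fq
... | no  fp⋠fq = inj₂ (inj₁ (p⪯q , fp⋠fq))

onSlice : ℕ → Pt → Pt
onSlice s₃ x = (p₁ x , p₂ x , s₃)

⪯-onSlice : ∀ {s₃} (x : Pt) → p₃ x ≤ s₃ → x ⪯ onSlice s₃ x
⪯-onSlice x x₃≤s₃ = ≤-refl , ≤-refl , x₃≤s₃

onSlice-⪯ : ∀ {s₃} (y : Pt) → s₃ ≤ p₃ y → onSlice s₃ y ⪯ y
onSlice-⪯ y s₃≤y₃ = ≤-refl , ≤-refl , s₃≤y₃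

UpS-onSlice : (f : Pt → Pt) (s₃ : ℕ) {x : Pt} →
              x ⪯ f x → f x ⪯ f (onSlice s₃ x) → UpS f s₃ (onSlice s₃ x)
UpS-onSlice f s₃ (x₁≤ , x₂≤ , _) (fx₁≤ , fx₂≤ , _) =
  ≤-trans x₁≤ fx₁≤ , ≤-trans x₂≤ fx₂≤ , ≤-refl

DownS-onSlice : (f : Pt → Pt) (s₃ : ℕ) {y : Pt} →
                f y ⪯ y → f (onSlice s₃ y) ⪯ f y → DownS f s₃ (onSlice s₃ y)
DownS-onSlice f s₃ (≤y₁ , ≤y₂ , _) (≤fy₁ , ≤fy₂ , _) =
  ≤-trans ≤fy₁ ≤y₁ , ≤-trans ≤fy₂ ≤y₂ , ≤-refl

lemma13 : (n : Pt) (f : Pt → Pt) → MapsL n f →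
    (x y : Pt) → InL n x → InL n y → x ⪯ y → x ⪯ f x → f y ⪯ y →
    (s₃ : ℕ) → p₃ x ≤ s₃ → s₃ ≤ p₃ y →
    Invariant n f s₃ (p₁ x , p₂ x , s₃) (p₁ y , p₂ y , s₃)
    ⊎ Violation f x (p₁ x , p₂ x , s₃)
    ⊎ Violation f (p₁ y , p₂ y , s₃) y
lemma13 n f _ x y _ _ _ x⪯fx fy⪯y s₃ x₃≤s₃ s₃≤y₃
  with ⪯-monotone-or-violation f (⪯-onSlice x x₃≤s₃)
     | ⪯-monotone-or-violation f (onSlice-⪯ y s₃≤y₃)
... | inj₂ lowViolation | _ = inj₂ (inj₁ lowViolation)
... | inj₁ _ | inj₂ highViolation = inj₂ (inj₂ highViolation)
... | inj₁ fx⪯fa | inj₁ fb⪯fy =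
  inj₁ (inj₁ (UpS-onSlice f s₃ x⪯fx fx⪯fa , DownS-onSlice f s₃ fy⪯y fb⪯fy))
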